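{- Each of $T(V)$, $T(W)$ and $T(X)$ is a graded algebra closed under the shuffle product $\sqcup$: if $z,z'$ both lie in one of these spaces, so does $z\sqcup z'$.
   Context: $\mathcal{A}$ is a finite alphabet with $q$ letters, $V_\mathcal{A}=\mathbb{C}^q$ with standard basis $\{e_a\}$, $V_\mathcal{A}^m$ its $m$-fold tensor power, $V_\mathcal{A}^0=\mathbb{C}$ (spanned by the empty word). $f_0=q^{ -1/2}\sum_a e_a$. For $m\ge1$, $\theta_L,\theta_R:V_\mathcal{A}^m\to V_\mathcal{A}^{m-1}$ are linear with $\theta_L(v_1\otimes\cdots\otimes v_m)=\langle f_0,v_1\rangle v_2\otimes\cdots\otimes v_m$, $\theta_R(v_1\otimes\cdots\otimes v_m)=\langle f_0,v_m\rangle v_1\otimes\cdots\otimes v_{m-1}$, and both are $0$ on $V_\mathcal{A}^0$. Set $W_\mathcal{A}^k=\ker(\theta_L-\theta_R)\subseteq V_\mathcal{A}^k$, $X_\mathcal{A}^k=\ker\theta_L\cap\ker\theta_R\subseteq V_\mathcal{A}^k$, and $T(V)=\bigoplus_{k\ge0}V_\mathcal{A}^k$, $T(W)=\bigoplus_{k\ge0}W_\mathcal{A}^k$, $T(X)=\bigoplus_{k\ge0}X_\mathcal{A}^k$. The shuffle product $\sqcup$ on $T(V)$ is the bilinear product that on elementary tensors $z_1\otimes\cdots\otimes z_k$, $z'_1\otimes\cdots\otimes z'_l$ is the sum over all interleavings of the factors preserving the order within each, with the empty word as unit. -}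

module Defs where

open import Level using (Level)
open import Data.Nat using (ℕ; zero; suc; _≤_)
open import Data.Fin using (Fin)
open import Data.List using (List; []; _∷_; _++_; [_]; length; map; foldr; allFin)
open import Data.Product using (_×_; _,_; ∃)
open import Algebra.Bundles using (CommutativeRing)

module _ {c ℓ : Level} (R : CommutativeRing c ℓ) (q : ℕ) where
  open CommutativeRing R

  -- The alphabet 𝒜 = Fin q.  Words are lists of letters; a word of length m
  -- is the basis tensor e_{a₁} ⊗ ⋯ ⊗ e_{a_m} of V^m.
  Word : Set
  Word = List (Fin q)

  -- An element of T(V) (before imposing finite support): its coefficient on
  -- every basis word.  The component in V^k is the restriction to words of
  -- length k.
  Tensor : Set c
  Tensor = Word → Carrier

  sumR : List Carrier → Carrier
  sumR = foldr _+_ 0#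

  Σ𝒜 : (Fin q → Carrier) → Carrier
  Σ𝒜 f = sumR (map f (allFin q))

  -- θ_L and θ_R, with κ playing the role of ⟨f₀, e_a⟩ = q^{-1/2} for each a.
  -- (θ z)(w) only involves the component of z of degree |w|+1, so θ maps
  -- V^m to V^{m-1} and kills V^0.
  θL : Carrier → Tensor → Tensor
  θL κ z w = κ * Σ𝒜 (λ a → z (a ∷ w))

  θR : Carrier → Tensor → Tensor
  θR κ z w = κ * Σ𝒜 (λ a → z (w ++ [ a ]))

  -- Finite support: z lies in the direct sum ⊕_k V^k.
  InTV : Tensor → Set ℓ
  InTV z = ∃ λ (N : ℕ) → ∀ (w : Word) → N ≤ length w → z w ≈ 0#

  -- T(W): finite support and every homogeneous component in ker(θ_L − θ_R).
  InTW : Carrier → Tensor → Set ℓ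
  InTW κ z = InTV z × (∀ (w : Word) → θL κ z w ≈ θR κ z w)

  -- T(X): finite support and every homogeneous component in ker θ_L ∩ ker θ_R.
  InTX : Carrier → Tensor → Set ℓ
  InTX κ z = InTV z × ((∀ (w : Word) → θL κ z w ≈ 0#) × (∀ (w : Word) → θR κ z w ≈ 0#))

  -- All ways to split a word w into two complementary subsequences (w₁, w₂),
  -- i.e. all subsets S of positions, giving (w|S, w|Sᶜ).
  splits : Word → List (Word × Word)
  splits [] = ([] , []) ∷ []
  splits (a ∷ w) =
    map (λ p → (a ∷ Data.Product.proj₁ p , Data.Product.proj₂ p)) (splits w)
    ++ map (λ p → (Data.Product.proj₁ p , a ∷ Data.Product.proj₂ p)) (splits w)

  -- On basis tensors this is exactly the sum over all order-preserving
  -- interleavings, extended bilinearly.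
  shuffle : Tensor → Tensor → Tensor
  shuffle z z' w = sumR (map (λ p → z (Data.Product.proj₁ p) * z' (Data.Product.proj₂ p)) (splits w))

  unitT : Tensor
  unitT [] = 1#
  unitT (_ ∷ _) = 0#

  natR : ℕ → Carrier
  natR zero = 0#
  natR (suc n) = 1# + natR n

-- θ_L and θ_R are derivations of the shuffle product: deleting the first
-- (last) letter of an interleaving of w₁ and w₂ deletes it from w₁ or from w₂,
-- so θ(z ⊔ z') = θz ⊔ z' + z ⊔ θz'.  Hence ker θ_L ∩ ker θ_R and ker(θ_L − θ_R)
-- are closed under ⊔.  Finite support is preserved because every split of a
-- word of length at least N + N' has a first part of length at least N or a
-- second part of length at least N'.
module Submission where

open import Defs
open import Level using (Level; _⊔_)
open import Data.Nat using (ℕ; suc)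
open import Data.Product using (_×_)
open import Algebra.Bundles using (CommutativeRing)

open import Algebra.Bundles using (CommutativeMonoid; Semiring)
open import Data.Nat using (_≤_; _≤?_) renaming (_+_ to _+ℕ_)
open import Data.Nat.Properties using (+-suc; ≰⇒>; +-mono-<; <⇒≱)
open import Data.Fin using (Fin)
open import Data.List using (List; []; _∷_; _++_; [_]; length; map; foldr; allFin)
open import Data.List.Properties using (map-∘)
open import Data.List.Relation.Unary.All as All using (All; []; _∷_)
open import Data.List.Relation.Unary.All.Properties using (map⁺; ++⁺)
open import Data.Product using (_,_; proj₁; proj₂)
open import Data.Empty using (⊥-elim)
open import Data.Sum using (_⊎_; inj₁; inj₂)
open import Function using (_∘_)
open import Relation.Nullary using (yes; no)
open import Relation.Binary.PropositionalEquality as ≡ using (_≡_)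
import Algebra.Properties.CommutativeSemigroup as CommutativeSemigroupProperties
import Relation.Binary.Reasoning.Setoid as SetoidReasoning

private
  variable
    a b : Level
    A : Set a
    B : Set b

≤-+-split : ∀ {m n i j} → m +ℕ n ≤ i +ℕ j → m ≤ i ⊎ n ≤ j
≤-+-split {m} {n} {i} {j} m+n≤i+j with m ≤? i | n ≤? j
... | yes m≤i | _       = inj₁ m≤i
... | no _    | yes n≤j = inj₂ n≤j
... | no m≰i  | no n≰j  = ⊥-elim (<⇒≱ (+-mono-< (≰⇒> m≰i) (≰⇒> n≰j)) m+n≤i+j)

module ListSum {c ℓ} (M : CommutativeMonoid c ℓ) where
  open CommutativeMonoid M
  open CommutativeSemigroupProperties commutativeSemigroup using (interchange)
  open SetoidReasoning setoid

  sumOver : List A → (A → Carrier) → Carrier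
  sumOver xs f = foldr _∙_ ε (map f xs)

  sumOver-cong : ∀ (xs : List A) {f g : A → Carrier} →
                 (∀ x → f x ≈ g x) → sumOver xs f ≈ sumOver xs g
  sumOver-cong []       f≈g = refl
  sumOver-cong (x ∷ xs) f≈g = ∙-cong (f≈g x) (sumOver-cong xs f≈g)

  sumOver-zero : ∀ (xs : List A) {f : A → Carrier} →
                 All (λ x → f x ≈ ε) xs → sumOver xs f ≈ ε
  sumOver-zero []       []             = refl
  sumOver-zero (x ∷ xs) (fx≈ε ∷ fxs≈ε) = trans (∙-cong fx≈ε (sumOver-zero xs fxs≈ε)) (identityˡ ε)

  sumOver-∙ : ∀ (xs : List A) (f g : A → Carrier) →
              sumOver xs (λ x → f x ∙ g x) ≈ sumOver xs f ∙ sumOver xs g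
  sumOver-∙ []       f g = sym (identityˡ ε)
  sumOver-∙ (x ∷ xs) f g =
    trans (∙-congˡ (sumOver-∙ xs f g)) (interchange (f x) (g x) _ _)

  sumOver-++ : ∀ (xs ys : List A) (f : A → Carrier) →
               sumOver (xs ++ ys) f ≈ sumOver xs f ∙ sumOver ys f
  sumOver-++ []       ys f = sym (identityˡ _)
  sumOver-++ (x ∷ xs) ys f = trans (∙-congˡ (sumOver-++ xs ys f)) (sym (assoc _ _ _))

  sumOver-map : ∀ (xs : List A) (h : A → B) (f : B → Carrier) →
                sumOver (map h xs) f ≈ sumOver xs (f ∘ h)
  sumOver-map xs h f = reflexive (≡.cong (foldr _∙_ ε) (≡.sym (map-∘ xs)))

  sumOver-comm : ∀ (xs : List A) (ys : List B) (f : A → B → Carrier) →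
                 sumOver xs (λ x → sumOver ys (f x)) ≈ sumOver ys (λ y → sumOver xs (λ x → f x y))
  sumOver-comm []       ys f = sym (sumOver-zero ys (All.tabulate (λ _ → refl)))
  sumOver-comm (x ∷ xs) ys f = begin
    sumOver ys (f x) ∙ sumOver xs (λ x → sumOver ys (f x))      ≈⟨ ∙-congˡ (sumOver-comm xs ys f) ⟩
    sumOver ys (f x) ∙ sumOver ys (λ y → sumOver xs (λ x → f x y)) ≈⟨ sym (sumOver-∙ ys (f x) _) ⟩
    sumOver ys (λ y → sumOver (x ∷ xs) (λ x → f x y))             ∎

module SemiringSum {c ℓ} (S : Semiring c ℓ) where
  open Semiring S
  open ListSum +-commutativeMonoid public

  *-distribˡ-sumOver : ∀ (xs : List A) (k : Carrier) (f : A → Carrier) →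
                       k * sumOver xs f ≈ sumOver xs (λ x → k * f x)
  *-distribˡ-sumOver []       k f = zeroʳ k
  *-distribˡ-sumOver (x ∷ xs) k f = trans (distribˡ k _ _) (+-congˡ (*-distribˡ-sumOver xs k f))

  *-distribʳ-sumOver : ∀ (xs : List A) (k : Carrier) (f : A → Carrier) →
                       sumOver xs f * k ≈ sumOver xs (λ x → f x * k)
  *-distribʳ-sumOver []       k f = zeroˡ k
  *-distribʳ-sumOver (x ∷ xs) k f = trans (distribʳ k _ _) (+-congˡ (*-distribʳ-sumOver xs k f))

module Shuffle {c ℓ : Level} (R : CommutativeRing c ℓ) (q : ℕ) where
  open CommutativeRing R
  open SemiringSum semiring
  open SetoidReasoning setoid

  Split : Set
  Split = Word R q × Word R q

  consˡ consʳ snocˡ snocʳ : Fin q → Split → Split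
  consˡ x (w₁ , w₂) = x ∷ w₁ , w₂
  consʳ x (w₁ , w₂) = w₁ , x ∷ w₂
  snocˡ x (w₁ , w₂) = w₁ ++ [ x ] , w₂
  snocʳ x (w₁ , w₂) = w₁ , w₂ ++ [ x ]

  splits-length : ∀ w → All (λ p → length (proj₁ p) +ℕ length (proj₂ p) ≡ length w) (splits R q w)
  splits-length []      = ≡.refl ∷ []
  splits-length (x ∷ w) = ++⁺
    (map⁺ (All.map (≡.cong suc) (splits-length w)))
    (map⁺ (All.map (λ {p} e → ≡.trans (+-suc (length (proj₁ p)) _) (≡.cong suc e)) (splits-length w)))

  sumOver-splits-∷ : ∀ w x (F : Split → Carrier) →
    sumOver (splits R q (x ∷ w)) F ≈
      sumOver (splits R q w) (F ∘ consˡ x) + sumOver (splits R q w) (F ∘ consʳ x)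
  sumOver-splits-∷ w x F = trans (sumOver-++ (map (consˡ x) ws) _ F)
      (+-cong (sumOver-map ws (consˡ x) F) (sumOver-map ws (consʳ x) F))
    where ws = splits R q w

  sumOver-splits-∷ʳ : ∀ w x (F : Split → Carrier) →
    sumOver (splits R q (w ++ [ x ])) F ≈
      sumOver (splits R q w) (F ∘ snocˡ x) + sumOver (splits R q w) (F ∘ snocʳ x)
  sumOver-splits-∷ʳ []      x F =
    +-cong (sym (+-identityʳ _)) (trans (+-identityʳ _) (sym (+-identityʳ _)))
  sumOver-splits-∷ʳ (y ∷ w) x F = begin
    sumOver (splits R q (y ∷ w ++ [ x ])) F
      ≈⟨ sumOver-splits-∷ (w ++ [ x ]) y F ⟩
    sumOver (splits R q (w ++ [ x ])) (F ∘ consˡ y) + sumOver (splits R q (w ++ [ x ])) (F ∘ consʳ y)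
      ≈⟨ +-cong (sumOver-splits-∷ʳ w x _) (sumOver-splits-∷ʳ w x _) ⟩
    (sumOver ws (F ∘ consˡ y ∘ snocˡ x) + sumOver ws (F ∘ consˡ y ∘ snocʳ x)) +
    (sumOver ws (F ∘ consʳ y ∘ snocˡ x) + sumOver ws (F ∘ consʳ y ∘ snocʳ x))
      ≈⟨ +-interchange _ _ _ _ ⟩
    (sumOver ws (F ∘ consˡ y ∘ snocˡ x) + sumOver ws (F ∘ consʳ y ∘ snocˡ x)) +
    (sumOver ws (F ∘ consˡ y ∘ snocʳ x) + sumOver ws (F ∘ consʳ y ∘ snocʳ x))
      ≈⟨ sym (+-cong (sumOver-splits-∷ w y _) (sumOver-splits-∷ w y _)) ⟩
    sumOver (splits R q (y ∷ w)) (F ∘ snocˡ x) + sumOver (splits R q (y ∷ w)) (F ∘ snocʳ x) ∎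
    where
    ws = splits R q w
    open CommutativeSemigroupProperties +-commutativeSemigroup
      using () renaming (interchange to +-interchange)

  shuffle-cong : ∀ {z₁ z₂ z₁' z₂' : Tensor R q} → (∀ w → z₁ w ≈ z₂ w) → (∀ w → z₁' w ≈ z₂' w) →
                 ∀ w → shuffle R q z₁ z₁' w ≈ shuffle R q z₂ z₂' w
  shuffle-cong z₁≈z₂ z₁'≈z₂' w =
    sumOver-cong (splits R q w) (λ p → *-cong (z₁≈z₂ (proj₁ p)) (z₁'≈z₂' (proj₂ p)))

  shuffle-zeroˡ : ∀ {z : Tensor R q} (z' : Tensor R q) → (∀ w → z w ≈ 0#) →
                  ∀ w → shuffle R q z z' w ≈ 0#
  shuffle-zeroˡ z' z≈0 w = sumOver-zero (splits R q w) (All.tabulate λ {p} _ → trans (*-congʳ (z≈0 (proj₁ p))) (zeroˡ _))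

  shuffle-zeroʳ : ∀ (z : Tensor R q) {z' : Tensor R q} → (∀ w → z' w ≈ 0#) →
                  ∀ w → shuffle R q z z' w ≈ 0#
  shuffle-zeroʳ z z'≈0 w = sumOver-zero (splits R q w) (All.tabulate λ {p} _ → trans (*-congˡ (z'≈0 (proj₂ p))) (zeroʳ _))

  shuffle-InTV : ∀ {z z' : Tensor R q} → InTV R q z → InTV R q z' → InTV R q (shuffle R q z z')
  shuffle-InTV {z} {z'} (N , z≈0) (N' , z'≈0) = N +ℕ N' , λ w N+N'≤∣w∣ →
    sumOver-zero (splits R q w) (All.map (vanishes w N+N'≤∣w∣) (splits-length w))
    where
    vanishes : ∀ w → N +ℕ N' ≤ length w → ∀ {p : Split} →
               length (proj₁ p) +ℕ length (proj₂ p) ≡ length w → z (proj₁ p) * z' (proj₂ p) ≈ 0#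
    vanishes w N+N'≤∣w∣ e with ≤-+-split (≡.subst (N +ℕ N' ≤_) (≡.sym e) N+N'≤∣w∣)
    ... | inj₁ N≤∣w₁∣  = trans (*-congʳ (z≈0 _ N≤∣w₁∣)) (zeroˡ _)
    ... | inj₂ N'≤∣w₂∣ = trans (*-congˡ (z'≈0 _ N'≤∣w₂∣)) (zeroʳ _)

  IsShuffleDerivation : (Tensor R q → Tensor R q) → Set (c ⊔ ℓ)
  IsShuffleDerivation θ = ∀ z z' w → θ (shuffle R q z z') w ≈ shuffle R q (θ z) z' w + shuffle R q z (θ z') w

  module Derivation
    (extend : Fin q → Word R q → Word R q)
    (sumOver-splits-extend : ∀ w x (F : Split → Carrier) →
       sumOver (splits R q (extend x w)) F ≈
         sumOver (splits R q w) (λ p → F (extend x (proj₁ p) , proj₂ p)) +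
         sumOver (splits R q w) (λ p → F (proj₁ p , extend x (proj₂ p))))
    (κ : Carrier) where

    θ : Tensor R q → Tensor R q
    θ z w = κ * sumOver (allFin q) (λ x → z (extend x w))

    scale-sumOver-comm : ∀ (ws : List Split) (G : Fin q → Split → Carrier) →
      κ * sumOver (allFin q) (λ x → sumOver ws (G x)) ≈ sumOver ws (λ p → κ * sumOver (allFin q) (λ x → G x p))
    scale-sumOver-comm ws G = begin
      κ * sumOver (allFin q) (λ x → sumOver ws (G x))     ≈⟨ *-congˡ (sumOver-comm (allFin q) ws G) ⟩
      κ * sumOver ws (λ p → sumOver (allFin q) (λ x → G x p)) ≈⟨ *-distribˡ-sumOver ws κ _ ⟩
      sumOver ws (λ p → κ * sumOver (allFin q) (λ x → G x p)) ∎

    θ-shuffle : IsShuffleDerivation θ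
    θ-shuffle z z' w = begin
      κ * sumOver (allFin q) (λ x → sumOver (splits R q (extend x w)) F)
        ≈⟨ *-congˡ (sumOver-cong (allFin q) (λ x → sumOver-splits-extend w x F)) ⟩
      κ * sumOver (allFin q) (λ x → sumOver ws (Fˡ x) + sumOver ws (Fʳ x))
        ≈⟨ *-congˡ (sumOver-∙ (allFin q) _ _) ⟩
      κ * (sumOver (allFin q) (λ x → sumOver ws (Fˡ x)) + sumOver (allFin q) (λ x → sumOver ws (Fʳ x)))
        ≈⟨ distribˡ κ _ _ ⟩
      κ * sumOver (allFin q) (λ x → sumOver ws (Fˡ x)) + κ * sumOver (allFin q) (λ x → sumOver ws (Fʳ x))
        ≈⟨ +-cong (scale-sumOver-comm ws Fˡ) (scale-sumOver-comm ws Fʳ) ⟩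
      sumOver ws (λ p → κ * sumOver (allFin q) (λ x → Fˡ x p)) +
      sumOver ws (λ p → κ * sumOver (allFin q) (λ x → Fʳ x p))
        ≈⟨ +-cong (sumOver-cong ws θ-left) (sumOver-cong ws θ-right) ⟩
      shuffle R q (θ z) z' w + shuffle R q z (θ z') w ∎
      where
      ws = splits R q w
      F : Split → Carrier
      F p = z (proj₁ p) * z' (proj₂ p)
      Fˡ Fʳ : Fin q → Split → Carrier
      Fˡ x p = F (extend x (proj₁ p) , proj₂ p)
      Fʳ x p = F (proj₁ p , extend x (proj₂ p))
      θ-left : ∀ p → κ * sumOver (allFin q) (λ x → Fˡ x p) ≈ θ z (proj₁ p) * z' (proj₂ p)
      θ-left p = trans (*-congˡ (sym (*-distribʳ-sumOver (allFin q) _ _))) (sym (*-assoc _ _ _))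
      θ-right : ∀ p → κ * sumOver (allFin q) (λ x → Fʳ x p) ≈ z (proj₁ p) * θ z' (proj₂ p)
      θ-right p = trans (*-congˡ (sym (*-distribˡ-sumOver (allFin q) _ _))) (x∙yz≈y∙xz κ _ _)
        where open CommutativeSemigroupProperties *-commutativeSemigroup using (x∙yz≈y∙xz)

  θL-shuffle : ∀ κ → IsShuffleDerivation (θL R q κ)
  θL-shuffle κ = Derivation.θ-shuffle _∷_ sumOver-splits-∷ κ

  θR-shuffle : ∀ κ → IsShuffleDerivation (θR R q κ)
  θR-shuffle κ = Derivation.θ-shuffle (λ x w → w ++ [ x ]) sumOver-splits-∷ʳ κ

  shuffle-kernel : ∀ {θ} → IsShuffleDerivation θ → ∀ {z z'} →
    (∀ w → θ z w ≈ 0#) → (∀ w → θ z' w ≈ 0#) → ∀ w → θ (shuffle R q z z') w ≈ 0#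
  shuffle-kernel θ-shuffle {z} {z'} θz≈0 θz'≈0 w = trans (θ-shuffle z z' w)
    (trans (+-cong (shuffle-zeroˡ z' θz≈0 w) (shuffle-zeroʳ z θz'≈0 w)) (+-identityʳ 0#))

  shuffle-equalizer : ∀ {θ₁ θ₂} → IsShuffleDerivation θ₁ → IsShuffleDerivation θ₂ → ∀ {z z'} →
    (∀ w → θ₁ z w ≈ θ₂ z w) → (∀ w → θ₁ z' w ≈ θ₂ z' w) →
    ∀ w → θ₁ (shuffle R q z z') w ≈ θ₂ (shuffle R q z z') w
  shuffle-equalizer {θ₁} {θ₂} θ₁-shuffle θ₂-shuffle {z} {z'} θ₁z≈θ₂z θ₁z'≈θ₂z' w = begin
    θ₁ (shuffle R q z z') w                               ≈⟨ θ₁-shuffle z z' w ⟩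
    shuffle R q (θ₁ z) z' w + shuffle R q z (θ₁ z') w
      ≈⟨ +-cong (shuffle-cong θ₁z≈θ₂z (λ _ → refl) w) (shuffle-cong (λ _ → refl) θ₁z'≈θ₂z' w) ⟩
    shuffle R q (θ₂ z) z' w + shuffle R q z (θ₂ z') w     ≈⟨ θ₂-shuffle z z' w ⟨
    θ₂ (shuffle R q z z') w                               ∎

  shuffle-InTW : ∀ {κ z z'} → InTW R q κ z → InTW R q κ z' → InTW R q κ (shuffle R q z z')
  shuffle-InTW {κ} (fin , θLz≈θRz) (fin' , θLz'≈θRz') =
    shuffle-InTV fin fin' , shuffle-equalizer (θL-shuffle κ) (θR-shuffle κ) θLz≈θRz θLz'≈θRz'

  shuffle-InTX : ∀ {κ z z'} → InTX R q κ z → InTX R q κ z' → InTX R q κ (shuffle R q z z')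
  shuffle-InTX {κ} (fin , θLz≈0 , θRz≈0) (fin' , θLz'≈0 , θRz'≈0) =
    shuffle-InTV fin fin' ,
    shuffle-kernel (θL-shuffle κ) θLz≈0 θLz'≈0 ,
    shuffle-kernel (θR-shuffle κ) θRz≈0 θRz'≈0

  InTX⇒InTW : ∀ {κ z} → InTX R q κ z → InTW R q κ z
  InTX⇒InTW (fin , θLz≈0 , θRz≈0) = fin , λ w → trans (θLz≈0 w) (sym (θRz≈0 w))

  unitT-InTV : InTV R q (unitT R q)
  unitT-InTV = 1 , λ { (_ ∷ _) _ → refl }

  unitT-∷ʳ : ∀ w x → unitT R q (w ++ [ x ]) ≈ 0#
  unitT-∷ʳ []      x = refl
  unitT-∷ʳ (_ ∷ _) x = refl

  unitT-InTX : ∀ {κ} → InTX R q κ (unitT R q)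
  unitT-InTX {κ} = unitT-InTV ,
    (λ w → scaled-zero (All.tabulate (λ _ → refl))) ,
    (λ w → scaled-zero (All.tabulate (λ {x} _ → unitT-∷ʳ w x)))
    where
    scaled-zero : ∀ {f : Fin q → Carrier} → All (λ x → f x ≈ 0#) (allFin q) → κ * sumOver (allFin q) f ≈ 0#
    scaled-zero f≈0 = trans (*-congˡ (sumOver-zero (allFin q) f≈0)) (zeroʳ κ)

mainTheorem7 : {c ℓ : Level} (R : CommutativeRing c ℓ) (q : ℕ) →
    let open CommutativeRing R in
    (κ : Carrier) → κ * κ * natR R q q ≈ 1# →
    (InTV R q (unitT R q) × InTW R q κ (unitT R q) × InTX R q κ (unitT R q))
    × (∀ (z z' : Tensor R q) → InTV R q z → InTV R q z' → InTV R q (shuffle R q z z'))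
    × (∀ (z z' : Tensor R q) → InTW R q κ z → InTW R q κ z' → InTW R q κ (shuffle R q z z'))
    × (∀ (z z' : Tensor R q) → InTX R q κ z → InTX R q κ z' → InTX R q κ (shuffle R q z z'))
mainTheorem7 R q κ _ =
  (unitT-InTV , InTX⇒InTW unitT-InTX , unitT-InTX) ,
  (λ _ _ → shuffle-InTV) , (λ _ _ → shuffle-InTW) , (λ _ _ → shuffle-InTX)
  where open Shuffle R q
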